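{- Let $k\ge 1$, let $G\in\{CC_k,CC_k^-\}$, let $S\subseteq V(G)$ be a cut of $G$, and let $i$ be an index such that $i$ and $i+1$ are both rows of $G$. Then: (i) if rows $i$ and $i+1$ are both monochromatic or both bi-chromatic with respect to $S$, then $cs(S_{\leftrightarrow i})=cs(S)$; (ii) otherwise (one of the two rows is monochromatic and the other bi-chromatic), there is a vertex $x\in\{v_i,v_{i+1},v'_i,v'_{i+1}\}$ that lies on one side of the cut $(S,V(G)\setminus S)$ while the other three lie on the other side, and $cs(S_{\leftrightarrow i})=cs(S)+1$ if $x\in\{v_i,v'_{i+1}\}$, and $cs(S_{\leftrightarrow i})=cs(S)-1$ otherwise.
   Context: For an integer $k\ge 0$, $CC_k$ is the graph with vertex set $K\cup K'$, where $K=\{v_0,\dots,v_k\}$ and $K'=\{v'_0,\dots,v'_k\}$, $K$ and $K'$ are cliques, and $v_i$ is adjacent to $v'_j$ if and only if $j<i$; there are no other edges. $CC_k^-$ is the graph $CC_k$ with the vertex $v'_k$ removed. For $G\in\{CC_k,CC_k^-\}$, row $i$ of $G$ is the pair $(v_i,v'_i)$ whenever both vertices belong to $G$ (so rows $0,\dots,k$ for $CC_k$ and rows $0,\dots,k-1$ for $CC_k^-$). A cut of $G$ is a subset $S\subseteq V(G)$, with $\bar S=V(G)\setminus S$; its cut size $cs(S)$ is the number of edges with exactly one endpoint in $S$. With respect to $S$, a row $i$ has one of four types $S\times S$, $\bar S\times\bar S$, $S\times\bar S$, $\bar S\times S$ according to whether $v_i$ and $v'_i$ are in $S$ or $\bar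 S$ (first coordinate for $v_i$, second for $v'_i$); it is monochromatic if of type $S\times S$ or $\bar S\times\bar S$ and bi-chromatic otherwise. For a cut $S$ and consecutive rows $i,i+1$, the cut $S_{\leftrightarrow i}$ is obtained by exchanging the types of rows $i$ and $i+1$: with $A=\{v_i,v_{i+1},v'_i,v'_{i+1}\}$, $S_{\leftrightarrow i}\setminus A=S\setminus A$, $v_i\in S_{\leftrightarrow i}\iff v_{i+1}\in S$, $v_{i+1}\in S_{\leftrightarrow i}\iff v_i\in S$, $v'_i\in S_{\leftrightarrow i}\iff v'_{i+1}\in S$, $v'_{i+1}\in S_{\leftrightarrow i}\iff v'_i\in S$. -}

module Defs where

open import Data.Nat using (ℕ; zero; suc; _+_; _<_; _<ᵇ_; _≟_; _<?_)
open import Data.Bool using (Bool; true; false; not; _∧_; if_then_else_)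
open import Data.Fin using (Fin; toℕ; fromℕ<)
open import Data.Fin.Properties using () renaming (_≟_ to _≟F_)
open import Data.List using (List; map; _++_; allFin; cartesianProductWith)
open import Data.Nat.ListAction using (sum)
open import Relation.Nullary using (yes; no; ¬_; ⌊_⌋)
open import Relation.Binary.PropositionalEquality using (_≡_)

data Graph : Set where
  CC CC⁻ : Graph

-- number of vertices on the K' side (= number of rows)
rows : Graph → ℕ → ℕ
rows CC  k = suc k
rows CC⁻ k = k

data Vertex (G : Graph) (k : ℕ) : Set where
  v  : Fin (suc k) → Vertex G k
  v' : Fin (rows G k) → Vertex G k

-- adjacency: K and K' are cliques, v i ~ v' j iff j < i
adj : {G : Graph} {k : ℕ} → Vertex G k → Vertex G k → Bool
adj (v i)  (v j)  = not ⌊ i ≟F j ⌋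
adj (v' i) (v' j) = not ⌊ i ≟F j ⌋
adj (v i)  (v' j) = toℕ j <ᵇ toℕ i
adj (v' j) (v i)  = toℕ j <ᵇ toℕ i

vertices : (G : Graph) (k : ℕ) → List (Vertex G k)
vertices G k = map v (allFin (suc k)) ++ map v' (allFin (rows G k))

-- a cut S ⊆ V(G), as its characteristic function (true = in S)
Cut : Graph → ℕ → Set
Cut G k = Vertex G k → Bool

-- cut size: number of edges with exactly one endpoint in S, counted as
-- ordered pairs (u , w) with u ∈ S, w ∉ S, u ~ w (each such edge once)
cs : {G : Graph} {k : ℕ} → Cut G k → ℕ
cs {G} {k} S = sum (cartesianProductWith
  (λ u w → if adj u w ∧ S u ∧ not (S w) then 1 else 0)
  (vertices G k) (vertices G k))

-- membership of v_j, v'_j in S, for a natural-number index j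
-- (default false outside the valid range; only used on valid indices)
inSv : {G : Graph} {k : ℕ} → Cut G k → ℕ → Bool
inSv {G} {k} S j with j <? suc k
... | yes p = S (v (fromℕ< p))
... | no _  = false

inSv' : {G : Graph} {k : ℕ} → Cut G k → ℕ → Bool
inSv' {G} {k} S j with j <? rows G k
... | yes p = S (v' (fromℕ< p))
... | no _  = false

Mono : {G : Graph} {k : ℕ} → Cut G k → ℕ → Set
Mono S j = inSv S j ≡ inSv' S j

Bi : {G : Graph} {k : ℕ} → Cut G k → ℕ → Set
Bi S j = ¬ Mono S j

-- transposition of the indices i and i+1 in Fin n (identity elsewhere)
swapFin : {n : ℕ} → ℕ → Fin n → Fin n
swapFin {n} i j with toℕ j ≟ i | toℕ j ≟ suc i
... | yes _ | _     with suc i <? n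
...   | yes p = fromℕ< p
...   | no _  = j
swapFin {n} i j | no _ | yes _ with i <? n
...   | yes p = fromℕ< p
...   | no _  = j
swapFin {n} i j | no _ | no _ = j

τ : {G : Graph} {k : ℕ} → ℕ → Vertex G k → Vertex G k
τ i (v j)  = v (swapFin i j)
τ i (v' j) = v' (swapFin i j)

swapRows : {G : Graph} {k : ℕ} → Cut G k → ℕ → Cut G k
swapRows S i u = S (τ i u)

data Four : Set where
  vᵢ vᵢ₊₁ v'ᵢ v'ᵢ₊₁ : Four

side : {G : Graph} {k : ℕ} → Cut G k → ℕ → Four → Bool
side S i vᵢ    = inSv S i
side S i vᵢ₊₁  = inSv S (suc i)
side S i v'ᵢ   = inSv' S i
side S i v'ᵢ₊₁ = inSv' S (suc i)

module Submission where

-- Write T = S_{↔i}.  As a characteristic function T = S ∘ τ, where τ is the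
-- involution of V(G) exchanging rows i and i+1.  The cut size is a double sum
-- over ordered vertex pairs of [a ~ b]·[a ∈ S, b ∉ S]; re-indexing both sums
-- by τ turns cs T into the same double sum with a ~ b replaced by τa ~ τb.
-- These two adjacencies differ only on the pair {v_{i+1}, v'_i} (an edge that
-- disappears) and the pair {v_i, v'_{i+1}} (a non-edge that appears), so
--   cs T + [S separates v_{i+1}, v'_i] = cs S + [S separates v_i, v'_{i+1}].
-- Both cases of the theorem are then Boolean case analyses on the sides of
-- the four vertices v_i, v_{i+1}, v'_i, v'_{i+1}.

open import Defs
open import Data.Nat using (ℕ; zero; suc; _+_; _*_; _<_; _≤_; _<ᵇ_; _≡ᵇ_; _≟_; _<?_; s≤s)
open import Data.Nat.Properties
  using (+-identityʳ; *-identityˡ; *-distribʳ-+; +-cancelʳ-≡; <-trans; n<1+n;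
         +-0-commutativeMonoid; +-commutativeSemigroup)
open import Data.Nat.ListAction using (sum)
open import Data.Bool using (Bool; true; false; not; _∧_; _xor_; if_then_else_)
open import Data.Bool.Properties using (∧-zeroʳ; ¬-not; xor-comm; not-distribʳ-xor)
open import Data.Fin using (Fin; toℕ; fromℕ<) renaming (zero to fzero; suc to fsuc)
open import Data.Fin.Properties using (toℕ-injective; toℕ-fromℕ<) renaming (_≟_ to _≟F_)
open import Data.Fin.Permutation using (Permutation′; permutation)
open import Data.List using ([]; _∷_; map; _++_; tabulate; allFin; cartesianProductWith)
open import Data.List.Properties using (map-++; map-∘; map-tabulate)
open import Data.Nat.ListAction.Properties using (sum-++)
open import Data.Product using (_×_; _,_; Σ)
open import Data.Sum using (_⊎_; inj₁; inj₂)
open import Data.Empty using (⊥-elim)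
open import Function using (_∘_; case_of_)
open import Relation.Nullary using (yes; no; ⌊_⌋)
open import Relation.Binary.PropositionalEquality
  using (_≡_; _≢_; ≢-sym; refl; sym; trans; cong; cong₂; module ≡-Reasoning)
open import Algebra.Properties.CommutativeMonoid.Sum +-0-commutativeMonoid
  using (sum-syntax; sum-cong-≗; sum-replicate-zero; ∑-distrib-+; ∑-comm; ∑-permute)
  renaming (sum to ∑)
open import Algebra.Properties.CommutativeSemigroup +-commutativeSemigroup
  using (interchange)

open ≡-Reasoning

when : Bool → ℕ → ℕ
when b n = if b then n else 0

𝟙 : Bool → ℕ
𝟙 b = when b 1

when-∧ : ∀ a b n → when (a ∧ b) n ≡ when a (when b n)
when-∧ true  b n = refl
when-∧ false b n = refl

when-𝟙 : ∀ b n → when b n ≡ 𝟙 b * n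
when-𝟙 true  n = sym (*-identityˡ n)
when-𝟙 false n = refl

when-scale : ∀ a b a' b' n → 𝟙 a + 𝟙 b ≡ 𝟙 a' + 𝟙 b' →
             when a n + when b n ≡ when a' n + when b' n
when-scale a b a' b' n eq = begin
  when a n + when b n    ≡⟨ cong₂ _+_ (when-𝟙 a n) (when-𝟙 b n) ⟩
  𝟙 a * n + 𝟙 b * n      ≡⟨ *-distribʳ-+ n (𝟙 a) (𝟙 b) ⟨
  (𝟙 a + 𝟙 b) * n        ≡⟨ cong (_* n) eq ⟩
  (𝟙 a' + 𝟙 b') * n      ≡⟨ *-distribʳ-+ n (𝟙 a') (𝟙 b') ⟩
  𝟙 a' * n + 𝟙 b' * n    ≡⟨ cong₂ _+_ (when-𝟙 a' n) (when-𝟙 b' n) ⟨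
  when a' n + when b' n  ∎

-- σ i is the transposition of i and i+1 on ℕ; swapFin is σ i read on Fin n.
σ : ℕ → ℕ → ℕ
σ zero    zero          = 1
σ zero    (suc zero)    = 0
σ zero    (suc (suc x)) = suc (suc x)
σ (suc i) zero          = 0
σ (suc i) (suc x)       = suc (σ i x)

σ-left : ∀ i → σ i i ≡ suc i
σ-left zero    = refl
σ-left (suc i) = cong suc (σ-left i)

σ-right : ∀ i → σ i (suc i) ≡ i
σ-right zero    = refl
σ-right (suc i) = cong suc (σ-right i)

σ-fixed : ∀ i x → x ≢ i → x ≢ suc i → σ i x ≡ x
σ-fixed zero    zero          x≢i _      = ⊥-elim (x≢i refl)
σ-fixed zero    (suc zero)    _   x≢1+i  = ⊥-elim (x≢1+i refl)
σ-fixed zero    (suc (suc x)) _   _      = refl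
σ-fixed (suc i) zero          _   _      = refl
σ-fixed (suc i) (suc x)       x≢i x≢1+i  =
  cong suc (σ-fixed i x (x≢i ∘ cong suc) (x≢1+i ∘ cong suc))

σ-involutive : ∀ i x → σ i (σ i x) ≡ x
σ-involutive zero    zero          = refl
σ-involutive zero    (suc zero)    = refl
σ-involutive zero    (suc (suc x)) = refl
σ-involutive (suc i) zero          = refl
σ-involutive (suc i) (suc x)       = cong suc (σ-involutive i x)

-- Transposing i and i+1 preserves the order β < α, except that it destroys it
-- for (α, β) = (i+1, i) and creates it for (α, β) = (i, i+1).
σ-<ᵇ : ∀ i α β → 𝟙 (σ i β <ᵇ σ i α) + 𝟙 ((α ≡ᵇ suc i) ∧ (β ≡ᵇ i))
               ≡ 𝟙 (β <ᵇ α) + 𝟙 ((α ≡ᵇ i) ∧ (β ≡ᵇ suc i))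
σ-<ᵇ zero zero          zero          = refl
σ-<ᵇ zero zero          (suc zero)    = refl
σ-<ᵇ zero zero          (suc (suc β)) = refl
σ-<ᵇ zero (suc zero)    zero          = refl
σ-<ᵇ zero (suc zero)    (suc zero)    = refl
σ-<ᵇ zero (suc zero)    (suc (suc β)) = refl
σ-<ᵇ zero (suc (suc α)) zero          = refl
σ-<ᵇ zero (suc (suc α)) (suc zero)    = refl
σ-<ᵇ zero (suc (suc α)) (suc (suc β)) = refl
σ-<ᵇ (suc i) zero    β       = refl
σ-<ᵇ (suc i) (suc α) zero
  rewrite ∧-zeroʳ (α ≡ᵇ suc i) | ∧-zeroʳ (α ≡ᵇ i) = refl
σ-<ᵇ (suc i) (suc α) (suc β) = σ-<ᵇ i α β

swapFin-toℕ : ∀ {n} i (j : Fin n) → suc i < n → toℕ (swapFin i j) ≡ σ i (toℕ j)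
swapFin-toℕ {n} i j 1+i<n with toℕ j ≟ i | toℕ j ≟ suc i
... | yes j≡i | _ with suc i <? n
...   | yes q = trans (toℕ-fromℕ< q) (sym (trans (cong (σ i) j≡i) (σ-left i)))
...   | no ¬q = ⊥-elim (¬q 1+i<n)
swapFin-toℕ {n} i j 1+i<n | no _ | yes j≡1+i with i <? n
...   | yes q = trans (toℕ-fromℕ< q) (sym (trans (cong (σ i) j≡1+i) (σ-right i)))
...   | no ¬q = ⊥-elim (¬q (<-trans (n<1+n i) 1+i<n))
swapFin-toℕ i j _ | no j≢i | no j≢1+i = sym (σ-fixed i (toℕ j) j≢i j≢1+i)

swapFin-involutive : ∀ {n} i (j : Fin n) → suc i < n → swapFin i (swapFin i j) ≡ j
swapFin-involutive i j 1+i<n = toℕ-injective (begin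
  toℕ (swapFin i (swapFin i j))  ≡⟨ swapFin-toℕ i (swapFin i j) 1+i<n ⟩
  σ i (toℕ (swapFin i j))        ≡⟨ cong (σ i) (swapFin-toℕ i j 1+i<n) ⟩
  σ i (σ i (toℕ j))              ≡⟨ σ-involutive i (toℕ j) ⟩
  toℕ j                          ∎)

swapₚ : ∀ {n} i → suc i < n → Permutation′ n
swapₚ i 1+i<n = permutation (swapFin i) (swapFin i)
  (λ j → swapFin-involutive i j 1+i<n) (λ j → swapFin-involutive i j 1+i<n)

≟-injective : ∀ {n} (f : Fin n → Fin n) → (∀ {x y} → f x ≡ f y → x ≡ y) →
              ∀ x y → ⌊ f x ≟F f y ⌋ ≡ ⌊ x ≟F y ⌋
≟-injective f inj x y with x ≟F y | f x ≟F f y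
... | yes _   | yes _     = refl
... | no _    | no _      = refl
... | yes x≡y | no fx≢fy  = ⊥-elim (fx≢fy (cong f x≡y))
... | no x≢y  | yes fx≡fy = ⊥-elim (x≢y (inj fx≡fy))

swapFin-≟ : ∀ {n} i → suc i < n → ∀ (x y : Fin n) →
            ⌊ swapFin i x ≟F swapFin i y ⌋ ≡ ⌊ x ≟F y ⌋
swapFin-≟ i 1+i<n = ≟-injective (swapFin i) λ {x} {y} eq → begin
  x                            ≡⟨ swapFin-involutive i x 1+i<n ⟨
  swapFin i (swapFin i x)      ≡⟨ cong (swapFin i) eq ⟩
  swapFin i (swapFin i y)      ≡⟨ swapFin-involutive i y 1+i<n ⟩
  y                            ∎

∑-zero : ∀ n → ∑[ j < n ] 0 ≡ 0
∑-zero = sum-replicate-zero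

∑-when : ∀ {n} b (f : Fin n → ℕ) → ∑[ j < n ] when b (f j) ≡ when b (∑[ j < n ] f j)
∑-when true  f = refl
∑-when {n} false f = ∑-zero n

∑-pick : ∀ n q (q<n : q < n) (f : Fin n → ℕ) →
         ∑[ j < n ] when (toℕ j ≡ᵇ q) (f j) ≡ f (fromℕ< q<n)
∑-pick (suc n) zero    _         f = trans (cong (f fzero +_) (∑-zero n)) (+-identityʳ _)
∑-pick (suc n) (suc q) (s≤s q<n) f = ∑-pick n q q<n (f ∘ fsuc)

∑∑-pick : ∀ m n P Q (P<m : P < m) (Q<n : Q < n) (h : Fin m → Fin n → ℕ) →
          ∑[ x < m ] ∑[ y < n ] when ((toℕ x ≡ᵇ P) ∧ (toℕ y ≡ᵇ Q)) (h x y)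
          ≡ h (fromℕ< P<m) (fromℕ< Q<n)
∑∑-pick m n P Q P<m Q<n h = begin
  ∑[ x < m ] ∑[ y < n ] when ((toℕ x ≡ᵇ P) ∧ (toℕ y ≡ᵇ Q)) (h x y)
    ≡⟨ sum-cong-≗ (λ x → sum-cong-≗ (λ y → when-∧ (toℕ x ≡ᵇ P) (toℕ y ≡ᵇ Q) (h x y))) ⟩
  ∑[ x < m ] ∑[ y < n ] when (toℕ x ≡ᵇ P) (when (toℕ y ≡ᵇ Q) (h x y))
    ≡⟨ sum-cong-≗ (λ x → ∑-when (toℕ x ≡ᵇ P) (λ y → when (toℕ y ≡ᵇ Q) (h x y))) ⟩
  ∑[ x < m ] when (toℕ x ≡ᵇ P) (∑[ y < n ] when (toℕ y ≡ᵇ Q) (h x y))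
    ≡⟨ sum-cong-≗ (λ x → cong (when (toℕ x ≡ᵇ P)) (∑-pick n Q Q<n (h x))) ⟩
  ∑[ x < m ] when (toℕ x ≡ᵇ P) (h x (fromℕ< Q<n))
    ≡⟨ ∑-pick m P P<m (λ x → h x (fromℕ< Q<n)) ⟩
  h (fromℕ< P<m) (fromℕ< Q<n)  ∎

sum-tabulate : ∀ n (f : Fin n → ℕ) → sum (tabulate f) ≡ ∑[ j < n ] f j
sum-tabulate zero    f = refl
sum-tabulate (suc n) f = cong (f fzero +_) (sum-tabulate n (f ∘ fsuc))

sum-allFin : ∀ n (f : Fin n → ℕ) → sum (map f (allFin n)) ≡ ∑[ j < n ] f j
sum-allFin n f = trans (cong sum (map-tabulate (λ j → j) f)) (sum-tabulate n f)

sum-cartesianProductWith : ∀ {A B : Set} (F : A → B → ℕ) xs ys →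
  sum (cartesianProductWith F xs ys) ≡ sum (map (λ x → sum (map (F x) ys)) xs)
sum-cartesianProductWith F []       ys = refl
sum-cartesianProductWith F (x ∷ xs) ys =
  trans (sum-++ (map (F x) ys) _) (cong (sum (map (F x) ys) +_) (sum-cartesianProductWith F xs ys))

rows<suc : ∀ G {k j} → j < rows G k → j < suc k
rows<suc CC  j<r = j<r
rows<suc CC⁻ j<r = <-trans j<r (n<1+n _)

module _ {G : Graph} {k : ℕ} where

  Σᵥ : (Vertex G k → ℕ) → ℕ
  Σᵥ f = ∑[ x < suc k ] f (v x) + ∑[ y < rows G k ] f (v' y)

  ΣΣ : (Vertex G k → Vertex G k → ℕ) → ℕ
  ΣΣ f = Σᵥ (λ a → Σᵥ (λ b → f a b))

  Σᵥ-cong : {f g : Vertex G k → ℕ} → (∀ a → f a ≡ g a) → Σᵥ f ≡ Σᵥ g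
  Σᵥ-cong eq = cong₂ _+_ (sum-cong-≗ (eq ∘ v)) (sum-cong-≗ (eq ∘ v'))

  Σᵥ-distrib-+ : (f g : Vertex G k → ℕ) → Σᵥ (λ a → f a + g a) ≡ Σᵥ f + Σᵥ g
  Σᵥ-distrib-+ f g =
    trans (cong₂ _+_ (∑-distrib-+ (f ∘ v) (g ∘ v)) (∑-distrib-+ (f ∘ v') (g ∘ v')))
          (interchange (∑[ x < suc k ] f (v x)) (∑[ x < suc k ] g (v x))
                       (∑[ y < rows G k ] f (v' y)) (∑[ y < rows G k ] g (v' y)))

  ΣΣ-cong : {f g : Vertex G k → Vertex G k → ℕ} → (∀ a b → f a b ≡ g a b) → ΣΣ f ≡ ΣΣ g
  ΣΣ-cong eq = Σᵥ-cong (λ a → Σᵥ-cong (eq a))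

  ΣΣ-distrib-+ : (f g : Vertex G k → Vertex G k → ℕ) →
                 ΣΣ (λ a b → f a b + g a b) ≡ ΣΣ f + ΣΣ g
  ΣΣ-distrib-+ f g = trans (Σᵥ-cong (λ a → Σᵥ-distrib-+ (f a) (g a)))
                           (Σᵥ-distrib-+ (λ a → Σᵥ (f a)) (λ a → Σᵥ (g a)))

  sum-vertices : (f : Vertex G k → ℕ) → sum (map f (vertices G k)) ≡ Σᵥ f
  sum-vertices f = begin
    sum (map f (map v (allFin (suc k)) ++ map v' (allFin (rows G k))))
      ≡⟨ cong sum (map-++ f (map v (allFin (suc k))) _) ⟩
    sum (map f (map v (allFin (suc k))) ++ map f (map v' (allFin (rows G k))))
      ≡⟨ sum-++ (map f (map v (allFin (suc k)))) _ ⟩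
    sum (map f (map v (allFin (suc k)))) + sum (map f (map v' (allFin (rows G k))))
      ≡⟨ cong₂ _+_ (cong sum (map-∘ (allFin (suc k)))) (cong sum (map-∘ (allFin (rows G k)))) ⟨
    sum (map (f ∘ v) (allFin (suc k))) + sum (map (f ∘ v') (allFin (rows G k)))
      ≡⟨ cong₂ _+_ (sum-allFin (suc k) (f ∘ v)) (sum-allFin (rows G k) (f ∘ v')) ⟩
    Σᵥ f  ∎

  cut : Cut G k → Vertex G k → Vertex G k → ℕ
  cut S a b = 𝟙 (S a ∧ not (S b))

  cs-ΣΣ : (S : Cut G k) → cs S ≡ ΣΣ (λ a b → when (adj a b) (cut S a b))
  cs-ΣΣ S = begin
    sum (cartesianProductWith F (vertices G k) (vertices G k))
      ≡⟨ sum-cartesianProductWith F (vertices G k) (vertices G k) ⟩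
    sum (map (λ a → sum (map (F a) (vertices G k))) (vertices G k))
      ≡⟨ sum-vertices _ ⟩
    Σᵥ (λ a → sum (map (F a) (vertices G k)))
      ≡⟨ Σᵥ-cong (λ a → sum-vertices (F a)) ⟩
    ΣΣ F
      ≡⟨ ΣΣ-cong (λ a b → when-∧ (adj a b) (S a ∧ not (S b)) 1) ⟩
    ΣΣ (λ a b → when (adj a b) (cut S a b))  ∎
    where
    F : Vertex G k → Vertex G k → ℕ
    F a b = if adj a b ∧ S a ∧ not (S b) then 1 else 0

  Σᵥ-τ : ∀ i → suc i < rows G k → (f : Vertex G k → ℕ) → Σᵥ (f ∘ τ i) ≡ Σᵥ f
  Σᵥ-τ i 1+i<r f = sym (cong₂ _+_ (∑-permute (f ∘ v) (swapₚ i 1+i<k))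
                                  (∑-permute (f ∘ v') (swapₚ i 1+i<r)))
    where
    1+i<k : suc i < suc k
    1+i<k = rows<suc G 1+i<r

  τ-involutive : ∀ i → suc i < rows G k → ∀ a → τ i (τ i a) ≡ a
  τ-involutive i 1+i<r (v x)  = cong v (swapFin-involutive i x (rows<suc G 1+i<r))
  τ-involutive i 1+i<r (v' y) = cong v' (swapFin-involutive i y 1+i<r)

  linked : ℕ → ℕ → Vertex G k → Vertex G k → Bool
  linked P Q (v x)  (v' y) = (toℕ x ≡ᵇ P) ∧ (toℕ y ≡ᵇ Q)
  linked P Q (v' y) (v x)  = (toℕ x ≡ᵇ P) ∧ (toℕ y ≡ᵇ Q)
  linked P Q (v _)  (v _)  = false
  linked P Q (v' _) (v' _) = false

  ΣΣ-linked : ∀ P Q (P<k : P < suc k) (Q<r : Q < rows G k) (g : Vertex G k → Vertex G k → ℕ) →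
    ΣΣ (λ a b → when (linked P Q a b) (g a b))
    ≡ g (v (fromℕ< P<k)) (v' (fromℕ< Q<r)) + g (v' (fromℕ< Q<r)) (v (fromℕ< P<k))
  ΣΣ-linked P Q P<k Q<r g = begin
    ∑[ x < suc k ] (∑[ z < suc k ] 0 + forward x) + ∑[ y < r ] (backward y + ∑[ z < r ] 0)
      ≡⟨ cong₂ _+_ (sum-cong-≗ λ x → cong (_+ forward x) (∑-zero (suc k)))
                   (sum-cong-≗ λ y → trans (cong (backward y +_) (∑-zero r)) (+-identityʳ _)) ⟩
    ∑[ x < suc k ] forward x + ∑[ y < r ] backward y
      ≡⟨ cong (∑[ x < suc k ] forward x +_) (∑-comm (λ y x → when (isP x ∧ isQ y) (g (v' y) (v x)))) ⟩
    ∑[ x < suc k ] forward x + ∑[ x < suc k ] ∑[ y < r ] when (isP x ∧ isQ y) (g (v' y) (v x))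
      ≡⟨ cong₂ _+_ (∑∑-pick (suc k) r P Q P<k Q<r (λ x y → g (v x) (v' y)))
                   (∑∑-pick (suc k) r P Q P<k Q<r (λ x y → g (v' y) (v x))) ⟩
    g (v (fromℕ< P<k)) (v' (fromℕ< Q<r)) + g (v' (fromℕ< Q<r)) (v (fromℕ< P<k))  ∎
    where
    r : ℕ
    r = rows G k
    isP : Fin (suc k) → Bool
    isP x = toℕ x ≡ᵇ P
    isQ : Fin r → Bool
    isQ y = toℕ y ≡ᵇ Q
    forward : Fin (suc k) → ℕ
    forward x = ∑[ y < r ] when (isP x ∧ isQ y) (g (v x) (v' y))
    backward : Fin r → ℕ
    backward y = ∑[ x < suc k ] when (isP x ∧ isQ y) (g (v' y) (v x))

-- Exchanging rows i and i+1 changes adjacency only on {v_{i+1}, v'_i}, which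
-- stops being an edge, and on {v_i, v'_{i+1}}, which becomes one.
adj-τ : ∀ {G k} i → suc i < rows G k → (a b : Vertex G k) →
        𝟙 (adj (τ i a) (τ i b)) + 𝟙 (linked (suc i) i a b)
        ≡ 𝟙 (adj a b) + 𝟙 (linked i (suc i) a b)
adj-τ {G} i 1+i<r (v x) (v y) =
  cong (λ t → 𝟙 (not t) + 0) (swapFin-≟ i (rows<suc G 1+i<r) x y)
adj-τ i 1+i<r (v' x) (v' y) =
  cong (λ t → 𝟙 (not t) + 0) (swapFin-≟ i 1+i<r x y)
adj-τ {G} i 1+i<r (v x) (v' y)
  rewrite swapFin-toℕ i x (rows<suc G 1+i<r) | swapFin-toℕ i y 1+i<r = σ-<ᵇ i (toℕ x) (toℕ y)
adj-τ {G} i 1+i<r (v' y) (v x)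
  rewrite swapFin-toℕ i x (rows<suc G 1+i<r) | swapFin-toℕ i y 1+i<r = σ-<ᵇ i (toℕ x) (toℕ y)

-- Re-indexing by τ: cs S_{↔i} is the cut double sum of S for the adjacency τa ~ τb.
cs-swapRows : ∀ {G k} (S : Cut G k) i → suc i < rows G k →
              cs (swapRows S i) ≡ ΣΣ (λ a b → when (adj (τ i a) (τ i b)) (cut S a b))
cs-swapRows S i 1+i<r = begin
  cs T
    ≡⟨ cs-ΣΣ T ⟩
  Σᵥ (λ a → Σᵥ (λ b → when (adj a b) (cut T a b)))
    ≡⟨ Σᵥ-τ i 1+i<r (λ a → Σᵥ (λ b → when (adj a b) (cut T a b))) ⟨
  Σᵥ (λ a → Σᵥ (λ b → when (adj (τ i a) b) (cut T (τ i a) b)))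
    ≡⟨ Σᵥ-cong (λ a → Σᵥ-τ i 1+i<r (λ b → when (adj (τ i a) b) (cut T (τ i a) b))) ⟨
  ΣΣ (λ a b → when (adj (τ i a) (τ i b)) (cut S (τ i (τ i a)) (τ i (τ i b))))
    ≡⟨ ΣΣ-cong (λ a b → cong₂ (λ a' b' → when (adj (τ i a) (τ i b)) (cut S a' b'))
                               (τ-involutive i 1+i<r a) (τ-involutive i 1+i<r b)) ⟩
  ΣΣ (λ a b → when (adj (τ i a) (τ i b)) (cut S a b))  ∎
  where
  T : Cut _ _
  T = swapRows S i

inSv-fromℕ< : ∀ {G k} (S : Cut G k) j (j<k : j < suc k) → inSv S j ≡ S (v (fromℕ< j<k))
inSv-fromℕ< {k = k} S j j<k with j <? suc k
... | yes _   = refl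
... | no j≮k = ⊥-elim (j≮k j<k)

inSv'-fromℕ< : ∀ {G k} (S : Cut G k) j (j<r : j < rows G k) → inSv' S j ≡ S (v' (fromℕ< j<r))
inSv'-fromℕ< {G} {k} S j j<r with j <? rows G k
... | yes _   = refl
... | no j≮r = ⊥-elim (j≮r j<r)

separated : ∀ x y → 𝟙 (x ∧ not y) + 𝟙 (y ∧ not x) ≡ 𝟙 (x xor y)
separated true  true  = refl
separated true  false = refl
separated false true  = refl
separated false false = refl

ΣΣ-linked-cut : ∀ {G k} (S : Cut G k) P Q → P < suc k → Q < rows G k →
                ΣΣ (λ a b → when (linked P Q a b) (cut S a b)) ≡ 𝟙 (inSv S P xor inSv' S Q)
ΣΣ-linked-cut S P Q P<k Q<r = begin
  ΣΣ (λ a b → when (linked P Q a b) (cut S a b))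
    ≡⟨ ΣΣ-linked P Q P<k Q<r (cut S) ⟩
  𝟙 (S (v (fromℕ< P<k)) ∧ not (S (v' (fromℕ< Q<r))))
    + 𝟙 (S (v' (fromℕ< Q<r)) ∧ not (S (v (fromℕ< P<k))))
    ≡⟨ separated (S (v (fromℕ< P<k))) (S (v' (fromℕ< Q<r))) ⟩
  𝟙 (S (v (fromℕ< P<k)) xor S (v' (fromℕ< Q<r)))
    ≡⟨ cong₂ (λ s s' → 𝟙 (s xor s')) (inSv-fromℕ< S P P<k) (inSv'-fromℕ< S Q Q<r) ⟨
  𝟙 (inSv S P xor inSv' S Q)  ∎

exchange : ∀ {G k} (S : Cut G k) i → suc i < rows G k →
           cs (swapRows S i) + 𝟙 (inSv S (suc i) xor inSv' S i)
           ≡ cs S + 𝟙 (inSv S i xor inSv' S (suc i))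
exchange {G} S i 1+i<r = begin
  cs (swapRows S i) + 𝟙 (inSv S (suc i) xor inSv' S i)
    ≡⟨ cong₂ _+_ (cs-swapRows S i 1+i<r) (sym (ΣΣ-linked-cut S (suc i) i 1+i<k i<r)) ⟩
  ΣΣ (λ a b → when (adj (τ i a) (τ i b)) (cut S a b))
    + ΣΣ (λ a b → when (linked (suc i) i a b) (cut S a b))
    ≡⟨ ΣΣ-distrib-+ (λ a b → when (adj (τ i a) (τ i b)) (cut S a b))
                    (λ a b → when (linked (suc i) i a b) (cut S a b)) ⟨
  ΣΣ (λ a b → when (adj (τ i a) (τ i b)) (cut S a b) + when (linked (suc i) i a b) (cut S a b))
    ≡⟨ ΣΣ-cong (λ a b → when-scale (adj (τ i a) (τ i b)) (linked (suc i) i a b) (adj a b)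
                                     (linked i (suc i) a b) (cut S a b) (adj-τ i 1+i<r a b)) ⟩
  ΣΣ (λ a b → when (adj a b) (cut S a b) + when (linked i (suc i) a b) (cut S a b))
    ≡⟨ ΣΣ-distrib-+ (λ a b → when (adj a b) (cut S a b))
                    (λ a b → when (linked i (suc i) a b) (cut S a b)) ⟩
  ΣΣ (λ a b → when (adj a b) (cut S a b))
    + ΣΣ (λ a b → when (linked i (suc i) a b) (cut S a b))
    ≡⟨ cong₂ _+_ (sym (cs-ΣΣ S)) (ΣΣ-linked-cut S i (suc i) i<k 1+i<r) ⟩
  cs S + 𝟙 (inSv S i xor inSv' S (suc i))  ∎
  where
  1+i<k : suc i < suc _
  1+i<k = rows<suc G 1+i<r
  i<r : i < rows G _
  i<r = <-trans (n<1+n i) 1+i<r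
  i<k : i < suc _
  i<k = rows<suc G i<r

same-kind : ∀ a b c d → (a ≡ c × b ≡ d) ⊎ (a ≢ c × b ≢ d) → b xor c ≡ a xor d
same-kind a b .a .b (inj₁ (refl , refl)) = xor-comm b a
same-kind a b c d (inj₂ (a≢c , b≢d))
  rewrite ¬-not (≢-sym a≢c) | ¬-not (≢-sym b≢d) = begin
    b xor not a    ≡⟨ not-distribʳ-xor b a ⟨
    not (b xor a)  ≡⟨ cong not (xor-comm b a) ⟩
    not (a xor b)  ≡⟨ not-distribʳ-xor a b ⟩
    a xor not b    ∎

OddOneOut : (Four → Bool) → Set
OddOneOut f = Σ Four λ x →
    ((y : Four) → y ≢ x → f y ≢ f x)
  × ((x ≡ vᵢ ⊎ x ≡ v'ᵢ₊₁) → f vᵢ xor f v'ᵢ₊₁ ≡ true × f vᵢ₊₁ xor f v'ᵢ ≡ false)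
  × ((x ≡ vᵢ₊₁ ⊎ x ≡ v'ᵢ) → f vᵢ xor f v'ᵢ₊₁ ≡ false × f vᵢ₊₁ xor f v'ᵢ ≡ true)

quad : Bool → Bool → Bool → Bool → Four → Bool
quad a b c d vᵢ    = a
quad a b c d vᵢ₊₁  = b
quad a b c d v'ᵢ   = c
quad a b c d v'ᵢ₊₁ = d

quad-η : (f : Four → Bool) → ∀ y → f y ≡ quad (f vᵢ) (f vᵢ₊₁) (f v'ᵢ) (f v'ᵢ₊₁) y
quad-η f vᵢ    = refl
quad-η f vᵢ₊₁  = refl
quad-η f v'ᵢ   = refl
quad-η f v'ᵢ₊₁ = refl

mono-bi : ∀ a d → OddOneOut (quad a (not d) a d)
mono-bi true  true  = vᵢ₊₁  , (λ { vᵢ _ () ; v'ᵢ _ () ; v'ᵢ₊₁ _ () ; vᵢ₊₁ ne _ → ne refl }) ,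
                      (λ { (inj₁ ()) ; (inj₂ ()) }) , (λ _ → refl , refl)
mono-bi true  false = v'ᵢ₊₁ , (λ { vᵢ _ () ; vᵢ₊₁ _ () ; v'ᵢ _ () ; v'ᵢ₊₁ ne _ → ne refl }) ,
                      (λ _ → refl , refl) , (λ { (inj₁ ()) ; (inj₂ ()) })
mono-bi false true  = v'ᵢ₊₁ , (λ { vᵢ _ () ; vᵢ₊₁ _ () ; v'ᵢ _ () ; v'ᵢ₊₁ ne _ → ne refl }) ,
                      (λ _ → refl , refl) , (λ { (inj₁ ()) ; (inj₂ ()) })
mono-bi false false = vᵢ₊₁  , (λ { vᵢ _ () ; v'ᵢ _ () ; v'ᵢ₊₁ _ () ; vᵢ₊₁ ne _ → ne refl }) ,
                      (λ { (inj₁ ()) ; (inj₂ ()) }) , (λ _ → refl , refl)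

bi-mono : ∀ a d → OddOneOut (quad a d (not a) d)
bi-mono true  true  = v'ᵢ , (λ { vᵢ _ () ; vᵢ₊₁ _ () ; v'ᵢ₊₁ _ () ; v'ᵢ ne _ → ne refl }) ,
                      (λ { (inj₁ ()) ; (inj₂ ()) }) , (λ _ → refl , refl)
bi-mono true  false = vᵢ  , (λ { vᵢ₊₁ _ () ; v'ᵢ _ () ; v'ᵢ₊₁ _ () ; vᵢ ne _ → ne refl }) ,
                      (λ _ → refl , refl) , (λ { (inj₁ ()) ; (inj₂ ()) })
bi-mono false true  = vᵢ  , (λ { vᵢ₊₁ _ () ; v'ᵢ _ () ; v'ᵢ₊₁ _ () ; vᵢ ne _ → ne refl }) ,
                      (λ _ → refl , refl) , (λ { (inj₁ ()) ; (inj₂ ()) })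
bi-mono false false = v'ᵢ , (λ { vᵢ _ () ; vᵢ₊₁ _ () ; v'ᵢ₊₁ _ () ; v'ᵢ ne _ → ne refl }) ,
                      (λ { (inj₁ ()) ; (inj₂ ()) }) , (λ _ → refl , refl)

odd-one-out-quad : ∀ a b c d → (a ≡ c × b ≢ d) ⊎ (a ≢ c × b ≡ d) → OddOneOut (quad a b c d)
odd-one-out-quad a b .a d (inj₁ (refl , b≢d)) rewrite ¬-not b≢d = mono-bi a d
odd-one-out-quad a b c .b (inj₂ (a≢c , refl)) rewrite ¬-not (≢-sym a≢c) = bi-mono a b

odd-one-out : (f : Four → Bool) →
  (f vᵢ ≡ f v'ᵢ × f vᵢ₊₁ ≢ f v'ᵢ₊₁) ⊎ (f vᵢ ≢ f v'ᵢ × f vᵢ₊₁ ≡ f v'ᵢ₊₁) → OddOneOut f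
odd-one-out f kinds = transfer (odd-one-out-quad (f vᵢ) (f vᵢ₊₁) (f v'ᵢ) (f v'ᵢ₊₁) kinds)
  where
  transfer : OddOneOut (quad (f vᵢ) (f vᵢ₊₁) (f v'ᵢ) (f v'ᵢ₊₁)) → OddOneOut f
  transfer (x , isolated , gain , loss) =
    x , (λ y y≢x fy≡fx → isolated y y≢x (trans (sym (quad-η f y)) (trans fy≡fx (quad-η f x)))) ,
    gain , loss

module ExchangeCases {m n : ℕ} (a b c d : Bool) (exch : m + 𝟙 (b xor c) ≡ n + 𝟙 (a xor d)) where

  unchanged : b xor c ≡ a xor d → m ≡ n
  unchanged eq = +-cancelʳ-≡ (𝟙 (a xor d)) m n (trans (cong (λ t → m + 𝟙 t) (sym eq)) exch)

  increased : a xor d ≡ true × b xor c ≡ false → m ≡ n + 1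
  increased (ad , bc) = begin
    m                  ≡⟨ +-identityʳ m ⟨
    m + 𝟙 false        ≡⟨ cong (λ t → m + 𝟙 t) bc ⟨
    m + 𝟙 (b xor c)    ≡⟨ exch ⟩
    n + 𝟙 (a xor d)    ≡⟨ cong (λ t → n + 𝟙 t) ad ⟩
    n + 1              ∎

  decreased : a xor d ≡ false × b xor c ≡ true → m + 1 ≡ n
  decreased (ad , bc) = begin
    m + 1              ≡⟨ cong (λ t → m + 𝟙 t) bc ⟨
    m + 𝟙 (b xor c)    ≡⟨ exch ⟩
    n + 𝟙 (a xor d)    ≡⟨ cong (λ t → n + 𝟙 t) ad ⟩
    n + 0              ≡⟨ +-identityʳ n ⟩
    n                  ∎

-- The theorem: the exchange identity read through the two Boolean case
-- analyses.
lemma1 : (k : ℕ) → 1 ≤ k → (G : Graph) → (S : Cut G k) → (i : ℕ) → suc i < rows G k →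
  (((Mono S i × Mono S (suc i)) ⊎ (Bi S i × Bi S (suc i))) →
     cs (swapRows S i) ≡ cs S)
  × (((Mono S i × Bi S (suc i)) ⊎ (Bi S i × Mono S (suc i))) →
     Σ Four (λ x →
       ((y : Four) → y ≢ x → side S i y ≢ side S i x)
       × ((x ≡ vᵢ ⊎ x ≡ v'ᵢ₊₁) → cs (swapRows S i) ≡ cs S + 1)
       × ((x ≡ vᵢ₊₁ ⊎ x ≡ v'ᵢ) → cs (swapRows S i) + 1 ≡ cs S)))
lemma1 k _ G S i 1+i<r =
  (λ kinds → unchanged (same-kind _ _ _ _ kinds)) ,
  (λ kinds → case odd-one-out (side S i) kinds of λ where
     (x , isolated , gain , loss) → x , isolated , increased ∘ gain , decreased ∘ loss)
  where
  open ExchangeCases (inSv S i) (inSv S (suc i)) (inSv' S i) (inSv' S (suc i)) (exchange S i 1+i<r)
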